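{- For every non-negative integer $n$ and indeterminates $X,Y$, \[ \sum_{\pi\in\mathfrak S_n}(X+1)^{\mathrm{RLmin}(\pi)-\mathrm{pivot}(\pi)}(X+Y)^{\mathrm{pivot}(\pi)}Y^{\mathrm{LRmax}(\pi)-\mathrm{pivot}(\pi)} =\sum_{\pi\in\mathfrak S_{n+1}}X^{\mathrm{RLmin}(\pi)-1}Y^{\mathrm{LRmax}(\pi)-\mathrm{pivot}(\pi)} . \]
   Context: $\mathfrak S_n$ is the set of permutations $\pi=\pi_1\cdots\pi_n$ of $\{1,\dots,n\}$ ($\mathfrak S_0$ consists of the empty permutation). $\pi_i$ is a right-to-left minimum if $\pi_i<\pi_j$ for all $j>i$, and a left-to-right maximum if $\pi_i>\pi_j$ for all $j<i$; $\mathrm{RLmin}(\pi)$, $\mathrm{LRmax}(\pi)$ are their numbers. A pivot is an entry that is both a left-to-right maximum and a right-to-left minimum; $\mathrm{pivot}(\pi)$ is their number. -}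

module Defs where

open import Data.Nat using (ℕ; zero; suc; _<_; _∸_; _<?_)
open import Data.Nat.Properties using (_≟_)
open import Data.List using (List; []; _∷_; map; concatMap; filter; length; upTo; foldr)
open import Data.List.Relation.Unary.All using (All; all?)
open import Data.List.Relation.Unary.Unique.Propositional using (Unique)
open import Data.List.Relation.Unary.AllPairs using (allPairs?)
open import Data.Product using (_×_; _,_)
open import Relation.Nullary using (¬?)
open import Relation.Nullary.Decidable using (_×-dec_)
open import Relation.Unary using (Decidable)
open import Algebra.Bundles using (CommutativeSemiring)
open import Level using (Level)

-- A permutation π = π₁⋯πₙ of {1,…,n} is represented by its one-line
-- notation, the list [π₁, …, πₙ] of natural numbers.

words : ℕ → ℕ → List (List ℕ)
words n zero    = [] ∷ []
words n (suc k) = concatMap (λ w → map (λ a → a ∷ w) (map suc (upTo n))) (words n k)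

unique? : Decidable (Unique {A = ℕ})
unique? = allPairs? (λ x y → ¬? (x ≟ y))

-- 𝔖ₙ : the words of length n over {1,…,n} with pairwise distinct letters,
-- i.e. exactly the permutations of {1,…,n} (each listed once).
𝔖 : ℕ → List (List ℕ)
𝔖 n = filter unique? (words n n)

-- each position i of π, as (π₁⋯π_{i-1} , πᵢ , π_{i+1}⋯πₙ)
Entry : Set
Entry = List ℕ × ℕ × List ℕ

entries : List ℕ → List Entry
entries []       = []
entries (x ∷ xs) = ([] , x , xs) ∷ map (λ { (p , y , s) → (x ∷ p , y , s) }) (entries xs)

isRLmin? : Decidable (λ (e : Entry) → let (p , x , s) = e in All (x <_) s)
isRLmin? (p , x , s) = all? (x <?_) s

isLRmax? : Decidable (λ (e : Entry) → let (p , x , s) = e in All (_< x) p)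
isLRmax? (p , x , s) = all? (_<? x) p

RLmin : List ℕ → ℕ
RLmin π = length (filter isRLmin? (entries π))

LRmax : List ℕ → ℕ
LRmax π = length (filter isLRmax? (entries π))

pivot : List ℕ → ℕ
pivot π = length (filter (λ e → isLRmax? e ×-dec isRLmin? e) (entries π))

module _ {c ℓ : Level} (R : CommutativeSemiring c ℓ) where
  open CommutativeSemiring R using (Carrier; _+_; 0#)
  sumOver : {A : Set} → List A → (A → Carrier) → Carrier
  sumOver xs f = foldr (λ a acc → f a + acc) 0# xs

-- Generalise both weights by a threshold t, counting only the left-to-right maxima and pivots of
-- value > t (leftWeight t and rightWeight t; on permutations t = 0 gives the weights of the theorem).
-- Every permutation of {1,…,n+1} is uniquely its first letter j+1 followed by a permutation w of
-- {1,…,n} relabelled by the order embedding punchIn (j+1).  Prepending j+1 multiplies either weight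
-- by a factor depending only on j and t, and changes the threshold seen by w to max(j, t-1).  Summing
-- over the first letter, induction on n gives
--   Σ_{w ∈ 𝔖ₙ} leftWeight t w = Σ_{σ ∈ 𝔖ₙ₊₁} rightWeight (t+1) σ :
-- the left term of the letter j+2 matches the right term of the letter j+3, and the left term of the
-- letter 1 is the sum of the right terms of the letters 1 and 2.  For t = 0 the latter reads
-- (X+Y)·R₁ = X·R₀ + Y·R₁ with Rₛ = rightWeight s σ, and R₀ = R₁ because the entry 1 of a permutation
-- is a left-to-right maximum only in first position, where it is also a pivot.

module Submission where

open import Defs
open import Level using (Level)
open import Algebra.Bundles using (CommutativeSemiring)
open import Algebra.Bundles using (module CommutativeSemiring)
open import Data.Bool using (Bool; true; false; _∧_; T)
open import Data.Bool.Properties using (∧-identityʳ; ∧-zeroʳ; ∧-assoc)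
open import Data.Nat as ℕ using (ℕ; zero; suc; pred; _∸_; _≤_; _<_; _<ᵇ_; _⊔_; z≤n; s≤s)
open import Data.Nat.Properties
  using ( suc-injective; ≤-refl; ≤-trans; n≤1+n; m≤n+m; +-mono-≤; ⊔-identityʳ; +-∸-assoc
        ; [m+n]∸[m+o]≡n∸o; module ≤-Reasoning )
open import Data.List using (List; []; _∷_; map; concatMap; _++_; filter; length; upTo; cartesianProductWith)
open import Data.List.Properties using (map-∘; map-upTo; length-map; map-injective; ∷-injective)
open import Data.List.Relation.Unary.All as All using (All; []; _∷_)
import Data.List.Relation.Unary.All.Properties as Allₚ
open import Data.List.Relation.Unary.Any using (here; there)
open import Data.List.Relation.Unary.AllPairs using ([]; _∷_)
open import Data.List.Relation.Unary.Unique.Propositional using (Unique)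
import Data.List.Relation.Unary.Unique.Propositional.Properties as Uniqueₚ
open import Data.List.Relation.Binary.Permutation.Propositional as ↭ using (_↭_)
open import Data.List.Relation.Binary.Permutation.Propositional.Properties using (∈-resp-↭)
open import Data.List.Relation.Binary.BagAndSetEquality using (∼bag⇒↭)
open import Data.List.Membership.Propositional using (_∈_)
open import Data.List.Membership.Propositional.Properties
  using ( ∈-map⁺; ∈-map⁻; ∈-upTo⁺; ∈-upTo⁻; ∈-filter⁺; ∈-filter⁻
        ; ∈-cartesianProductWith⁺; ∈-cartesianProductWith⁻ )
open import Data.List.Membership.Propositional.Properties.WithK using (unique∧set⇒bag)
open import Data.Product using (_×_; _,_; proj₁; proj₂; ∃₂; swap)
open import Function using (_∘_)
open import Function.Bundles using (mk⇔)
open import Relation.Nullary using (does)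
open import Relation.Unary using (Decidable)
open import Relation.Binary.PropositionalEquality as ≡
  using (_≡_; _≢_; cong; cong₂; subst; module ≡-Reasoning)

bit : Bool → ℕ
bit true  = 1
bit false = 0

countᵇ : {A : Set} → (A → Bool) → List A → ℕ
countᵇ p []       = 0
countᵇ p (x ∷ xs) = bit (p x) ℕ.+ countᵇ p xs

module _ {A : Set} where

  length-filter≡countᵇ : {P : A → Set} (P? : Decidable P) (xs : List A) →
                         length (filter P? xs) ≡ countᵇ (does ∘ P?) xs
  length-filter≡countᵇ P? []       = ≡.refl
  length-filter≡countᵇ P? (x ∷ xs) with does (P? x)
  ... | true  = cong suc (length-filter≡countᵇ P? xs)
  ... | false = length-filter≡countᵇ P? xs

  countᵇ-map : {B : Set} (p : B → Bool) (f : A → B) (xs : List A) → countᵇ p (map f xs) ≡ countᵇ (p ∘ f) xs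
  countᵇ-map p f []       = ≡.refl
  countᵇ-map p f (x ∷ xs) = cong (bit (p (f x)) ℕ.+_) (countᵇ-map p f xs)

  countᵇ-cong : {p q : A → Bool} {xs : List A} → All (λ x → p x ≡ q x) xs → countᵇ p xs ≡ countᵇ q xs
  countᵇ-cong []             = ≡.refl
  countᵇ-cong (px≡qx ∷ p≡q) = cong₂ ℕ._+_ (cong bit px≡qx) (countᵇ-cong p≡q)

  countᵇ-mono : {p q : A → Bool} (xs : List A) → (∀ x → T (p x) → T (q x)) → countᵇ p xs ≤ countᵇ q xs
  countᵇ-mono []       p⇒q = z≤n
  countᵇ-mono (x ∷ xs) p⇒q = +-mono-≤ (bit-mono (p⇒q x)) (countᵇ-mono xs p⇒q)
    where
    bit-mono : {a b : Bool} → (T a → T b) → bit a ≤ bit b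
    bit-mono {false}         _   = z≤n
    bit-mono {true}  {true}  _   = ≤-refl
    bit-mono {true}  {false} a⇒b with () ← a⇒b _

∧-rotate : ∀ a b c → (a ∧ b) ∧ c ≡ b ∧ (a ∧ c)
∧-rotate true  b c = ≡.refl
∧-rotate false b c = ≡.sym (∧-zeroʳ b)

value : Entry → ℕ
value (p , x , s) = x

isLR isRL : Entry → Bool
isLR e = does (isLRmax? e)
isRL e = does (isRLmin? e)

-- entries (x ∷ w) reduces to ([] , x , w) ∷ map (consEntry x) (entries w).
consEntry : ℕ → Entry → Entry
consEntry x (p , y , s) = x ∷ p , y , s

mapEntry : (ℕ → ℕ) → Entry → Entry
mapEntry f (p , x , s) = map f p , f x , map f s

entries-map : ∀ f w → entries (map f w) ≡ map (mapEntry f) (entries w)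
entries-map f []      = ≡.refl
entries-map f (x ∷ w) = cong (([] , f x , map f w) ∷_) (begin
  map (consEntry (f x)) (entries (map f w))              ≡⟨ cong (map (consEntry (f x))) (entries-map f w) ⟩
  map (consEntry (f x)) (map (mapEntry f) (entries w))  ≡⟨ map-∘ (entries w) ⟨
  map (mapEntry f ∘ consEntry x) (entries w)            ≡⟨ map-∘ (entries w) ⟩
  map (mapEntry f) (map (consEntry x) (entries w))      ∎)
  where open ≡-Reasoning

entries-values : ∀ w → map value (entries w) ≡ w
entries-values []      = ≡.refl
entries-values (x ∷ w) = cong (x ∷_) (≡.trans (≡.sym (map-∘ (entries w))) (entries-values w))

OrderEmbedding : (ℕ → ℕ) → Set
OrderEmbedding f = ∀ x y → (f x <ᵇ f y) ≡ (x <ᵇ y)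

module _ {f : ℕ → ℕ} (f-emb : OrderEmbedding f) where

  isRL-mapEntry : ∀ e → isRL (mapEntry f e) ≡ isRL e
  isRL-mapEntry (p , x , [])    = ≡.refl
  isRL-mapEntry (p , x , y ∷ s) = cong₂ _∧_ (f-emb x y) (isRL-mapEntry (p , x , s))

  isLR-mapEntry : ∀ e → isLR (mapEntry f e) ≡ isLR e
  isLR-mapEntry ([]    , x , s) = ≡.refl
  isLR-mapEntry (y ∷ p , x , s) = cong₂ _∧_ (f-emb y x) (isLR-mapEntry (p , x , s))

-- Inserting and removing a value

punchIn : ℕ → ℕ → ℕ
punchIn zero    x       = suc x
punchIn (suc a) zero    = zero
punchIn (suc a) (suc x) = suc (punchIn a x)

punchOut : ℕ → ℕ → ℕ
punchOut zero    y       = pred y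
punchOut (suc a) zero    = zero
punchOut (suc a) (suc y) = suc (punchOut a y)

punchIn-orderEmbedding : ∀ a → OrderEmbedding (punchIn a)
punchIn-orderEmbedding zero    x       y       = ≡.refl
punchIn-orderEmbedding (suc a) zero    zero    = ≡.refl
punchIn-orderEmbedding (suc a) zero    (suc y) = ≡.refl
punchIn-orderEmbedding (suc a) (suc x) zero    = ≡.refl
punchIn-orderEmbedding (suc a) (suc x) (suc y) = punchIn-orderEmbedding a x y

punchIn-injective : ∀ a {x y} → punchIn a x ≡ punchIn a y → x ≡ y
punchIn-injective zero                    eq = suc-injective eq
punchIn-injective (suc a) {zero}  {zero}  eq = ≡.refl
punchIn-injective (suc a) {suc x} {suc y} eq = cong suc (punchIn-injective a (suc-injective eq))

punchIn≢ : ∀ a x → a ≢ punchIn a x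
punchIn≢ zero    x       ()
punchIn≢ (suc a) (suc x) eq = punchIn≢ a x (suc-injective eq)

x≤punchIn : ∀ a x → x ≤ punchIn a x
x≤punchIn zero    x       = n≤1+n x
x≤punchIn (suc a) zero    = z≤n
x≤punchIn (suc a) (suc x) = s≤s (x≤punchIn a x)

punchIn≤suc : ∀ a x → punchIn a x ≤ suc x
punchIn≤suc zero    x       = ≤-refl
punchIn≤suc (suc a) zero    = z≤n
punchIn≤suc (suc a) (suc x) = s≤s (punchIn≤suc a x)

punchIn-punchOut : ∀ {a y} → a ≢ y → punchIn a (punchOut a y) ≡ y
punchIn-punchOut {zero}  {zero}  0≢0 with () ← 0≢0 ≡.refl
punchIn-punchOut {zero}  {suc y} _   = ≡.refl
punchIn-punchOut {suc a} {zero}  _   = ≡.refl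
punchIn-punchOut {suc a} {suc y} a≢y = cong suc (punchIn-punchOut (a≢y ∘ cong suc))

punchOut-< : ∀ {a y n} → a ≢ y → a ≤ n → y ≤ n → punchOut a y < n
punchOut-< {zero}  {zero}          0≢0 _         _         with () ← 0≢0 ≡.refl
punchOut-< {zero}  {suc y}         _   _         y<n       = y<n
punchOut-< {suc a} {zero}          _   (s≤s _)   _         = s≤s z≤n
punchOut-< {suc a} {suc y} {suc n} a≢y (s≤s a≤n) (s≤s y≤n) = s≤s (punchOut-< (a≢y ∘ cong suc) a≤n y≤n)

<ᵇ-punchIn : ∀ a x → (a <ᵇ punchIn a x) ≡ (a <ᵇ suc x)
<ᵇ-punchIn zero    x       = ≡.refl
<ᵇ-punchIn (suc a) zero    = ≡.refl
<ᵇ-punchIn (suc a) (suc x) = <ᵇ-punchIn a x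

punchIn-above : ∀ a t x → ((a <ᵇ punchIn a x) ∧ (t <ᵇ punchIn a x)) ≡ ((a ⊔ t) <ᵇ suc x)
punchIn-above zero    t       x       = ≡.refl
punchIn-above (suc a) zero    zero    = ≡.refl
punchIn-above (suc a) (suc t) zero    = ≡.refl
punchIn-above (suc a) zero    (suc x) = ≡.trans (∧-identityʳ _) (<ᵇ-punchIn a x)
punchIn-above (suc a) (suc t) (suc x) = punchIn-above a t x

suc-⊔ : ∀ m t → suc m ⊔ t ≡ suc (m ⊔ pred t)
suc-⊔ m zero    = cong suc (≡.sym (⊔-identityʳ m))
suc-⊔ m (suc t) = ≡.refl

suc-above : ∀ j t x → ((suc j <ᵇ punchIn (suc j) x) ∧ (t <ᵇ punchIn (suc j) x)) ≡ ((j ⊔ pred t) <ᵇ x)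
suc-above j t x = ≡.trans (punchIn-above (suc j) t x) (cong (_<ᵇ suc x) (suc-⊔ j t))

prepend : ℕ → List ℕ → List ℕ
prepend a w = a ∷ map (punchIn a) w

liftEntry : ℕ → Entry → Entry
liftEntry a (p , x , s) = a ∷ map (punchIn a) p , punchIn a x , map (punchIn a) s

entries-prepend : ∀ a w → entries (prepend a w) ≡ ([] , a , map (punchIn a) w) ∷ map (liftEntry a) (entries w)
entries-prepend a w = cong (([] , a , map (punchIn a) w) ∷_)
  (≡.trans (cong (map (consEntry a)) (entries-map (punchIn a) w)) (≡.sym (map-∘ (entries w))))

countᵇ-entries-prepend : ∀ {p q : Entry → Bool} a w → (∀ e → p (liftEntry a e) ≡ q e) →
  countᵇ p (entries (prepend a w)) ≡ bit (p ([] , a , map (punchIn a) w)) ℕ.+ countᵇ q (entries w)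
countᵇ-entries-prepend {p} {q} a w p∘lift≡q = begin
  countᵇ p (entries (prepend a w))
    ≡⟨ cong (countᵇ p) (entries-prepend a w) ⟩
  first ℕ.+ countᵇ p (map (liftEntry a) (entries w))
    ≡⟨ cong (first ℕ.+_) (countᵇ-map p (liftEntry a) (entries w)) ⟩
  first ℕ.+ countᵇ (p ∘ liftEntry a) (entries w)
    ≡⟨ cong (first ℕ.+_) (countᵇ-cong (All.universal p∘lift≡q (entries w))) ⟩
  first ℕ.+ countᵇ q (entries w)
    ∎
  where
  open ≡-Reasoning
  first = bit (p ([] , a , map (punchIn a) w))

isRL-liftEntry : ∀ a e → isRL (liftEntry a e) ≡ isRL e
isRL-liftEntry a (p , x , s) = isRL-mapEntry (punchIn-orderEmbedding a) (p , x , s)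

isLR-liftEntry : ∀ a e → isLR (liftEntry a e) ≡ (a <ᵇ punchIn a (value e)) ∧ isLR e
isLR-liftEntry a (p , x , s) = cong ((a <ᵇ punchIn a x) ∧_) (isLR-mapEntry (punchIn-orderEmbedding a) (p , x , s))

-- Statistics above a threshold

rlmins : List ℕ → ℕ
rlmins w = countᵇ isRL (entries w)

lrmaxAbove pivotsAbove : ℕ → List ℕ → ℕ
lrmaxAbove  t w = countᵇ (λ e → isLR e ∧ (t <ᵇ value e)) (entries w)
pivotsAbove t w = countᵇ (λ e → (isLR e ∧ isRL e) ∧ (t <ᵇ value e)) (entries w)

Stats : Set
Stats = ℕ × ℕ × ℕ

stats : ℕ → List ℕ → Stats
stats t w = rlmins w , pivotsAbove t w , lrmaxAbove t w

stats-0 : ∀ {w} → All (1 ≤_) w → (RLmin w , pivot w , LRmax w) ≡ stats 0 w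
stats-0 {w} pos = cong₂ _,_ (length-filter≡countᵇ isRLmin? (entries w)) (cong₂ _,_
  (≡.trans (length-filter≡countᵇ _ (entries w)) (≡.sym (countᵇ-above-0 (λ e → isLR e ∧ isRL e))))
  (≡.trans (length-filter≡countᵇ isLRmax? (entries w)) (≡.sym (countᵇ-above-0 isLR))))
  where
  values-positive : All (λ e → 1 ≤ value e) (entries w)
  values-positive = Allₚ.map⁻ (subst (All (1 ≤_)) (≡.sym (entries-values w)) pos)
  countᵇ-above-0 : ∀ p → countᵇ (λ e → p e ∧ (0 <ᵇ value e)) (entries w) ≡ countᵇ p (entries w)
  countᵇ-above-0 p = countᵇ-cong (All.map (λ { {e} (s≤s _) → ∧-identityʳ (p e) }) values-positive)

pivotsAbove≤rlmins : ∀ t w → pivotsAbove t w ≤ rlmins w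
pivotsAbove≤rlmins t w = countᵇ-mono (entries w) λ e → pivot⇒rl (isLR e) (isRL e) _
  where
  pivot⇒rl : ∀ l r c → T ((l ∧ r) ∧ c) → T r
  pivot⇒rl true true true _ = _

pivotsAbove≤lrmaxAbove : ∀ t w → pivotsAbove t w ≤ lrmaxAbove t w
pivotsAbove≤lrmaxAbove t w = countᵇ-mono (entries w) λ e → pivot⇒lr (isLR e) (isRL e) _
  where
  pivot⇒lr : ∀ l r c → T ((l ∧ r) ∧ c) → T (l ∧ c)
  pivot⇒lr true true true _ = _

1≤rlmins : ∀ x w → 1 ≤ rlmins (x ∷ w)
1≤rlmins x []      = s≤s z≤n
1≤rlmins x (y ∷ w) = begin
  1                          ≤⟨ 1≤rlmins y w ⟩
  rlmins (y ∷ w)             ≤⟨ m≤n+m (rlmins (y ∷ w)) first ⟩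
  first ℕ.+ rlmins (y ∷ w)   ≡⟨ cong (first ℕ.+_) (countᵇ-map isRL (consEntry x) (entries (y ∷ w))) ⟨
  rlmins (x ∷ y ∷ w)         ∎
  where
  open ≤-Reasoning
  first = bit (isRL ([] , x , y ∷ w))

firstIsRLmin : ℕ → List ℕ → Bool
firstIsRLmin a w = isRL ([] , a , map (punchIn a) w)

stats-prepend : ∀ j t w →
  stats t (prepend (suc j) w) ≡
    ( bit (firstIsRLmin (suc j) w) ℕ.+ rlmins w
    , bit (firstIsRLmin (suc j) w ∧ (t <ᵇ suc j)) ℕ.+ pivotsAbove (j ⊔ pred t) w
    , bit (t <ᵇ suc j) ℕ.+ lrmaxAbove (j ⊔ pred t) w )
stats-prepend j t w = cong₂ _,_ (countᵇ-entries-prepend a w (isRL-liftEntry a))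
                     (cong₂ _,_ (countᵇ-entries-prepend a w pivots) (countᵇ-entries-prepend a w lrmaxima))
  where
  open ≡-Reasoning
  a = suc j
  lrmaxima : ∀ e → isLR (liftEntry a e) ∧ (t <ᵇ value (liftEntry a e)) ≡ isLR e ∧ ((j ⊔ pred t) <ᵇ value e)
  lrmaxima e@(p , x , s) = begin
    isLR (liftEntry a e) ∧ (t <ᵇ punchIn a x)                 ≡⟨ cong (_∧ (t <ᵇ punchIn a x)) (isLR-liftEntry a e) ⟩
    ((a <ᵇ punchIn a x) ∧ isLR e) ∧ (t <ᵇ punchIn a x)        ≡⟨ ∧-rotate (a <ᵇ punchIn a x) (isLR e) _ ⟩
    isLR e ∧ ((a <ᵇ punchIn a x) ∧ (t <ᵇ punchIn a x))        ≡⟨ cong (isLR e ∧_) (suc-above j t x) ⟩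
    isLR e ∧ ((j ⊔ pred t) <ᵇ x)                              ∎
  pivots : ∀ e → (isLR (liftEntry a e) ∧ isRL (liftEntry a e)) ∧ (t <ᵇ value (liftEntry a e)) ≡
                 (isLR e ∧ isRL e) ∧ ((j ⊔ pred t) <ᵇ value e)
  pivots e@(p , x , s) = begin
    (isLR (liftEntry a e) ∧ isRL (liftEntry a e)) ∧ (t <ᵇ punchIn a x)
      ≡⟨ cong₂ (λ l r → (l ∧ r) ∧ (t <ᵇ punchIn a x)) (isLR-liftEntry a e) (isRL-liftEntry a e) ⟩
    (((a <ᵇ punchIn a x) ∧ isLR e) ∧ isRL e) ∧ (t <ᵇ punchIn a x)
      ≡⟨ cong (_∧ (t <ᵇ punchIn a x)) (∧-assoc (a <ᵇ punchIn a x) (isLR e) (isRL e)) ⟩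
    ((a <ᵇ punchIn a x) ∧ (isLR e ∧ isRL e)) ∧ (t <ᵇ punchIn a x)
      ≡⟨ ∧-rotate (a <ᵇ punchIn a x) (isLR e ∧ isRL e) _ ⟩
    (isLR e ∧ isRL e) ∧ ((a <ᵇ punchIn a x) ∧ (t <ᵇ punchIn a x))
      ≡⟨ cong ((isLR e ∧ isRL e) ∧_) (suc-above j t x) ⟩
    (isLR e ∧ isRL e) ∧ ((j ⊔ pred t) <ᵇ x)
      ∎

firstIsRLmin-1 : ∀ {w} → All (1 ≤_) w → firstIsRLmin 1 w ≡ true
firstIsRLmin-1 []              = ≡.refl
firstIsRLmin-1 (s≤s z≤n ∷ pos) = firstIsRLmin-1 pos

firstIsRLmin-suc : ∀ j {w} → 1 ∈ w → firstIsRLmin (suc (suc j)) w ≡ false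
firstIsRLmin-suc j (here ≡.refl) = ≡.refl
firstIsRLmin-suc j {x ∷ w} (there 1∈w) =
  ≡.trans (cong ((suc (suc j) <ᵇ punchIn (suc (suc j)) x) ∧_) (firstIsRLmin-suc j 1∈w)) (∧-zeroʳ _)

stats-prepend-1 : ∀ t {w} → All (1 ≤_) w →
  stats t (prepend 1 w) ≡
    (suc (rlmins w) , bit (t <ᵇ 1) ℕ.+ pivotsAbove (pred t) w , bit (t <ᵇ 1) ℕ.+ lrmaxAbove (pred t) w)
stats-prepend-1 t {w} pos =
  ≡.trans (stats-prepend 0 t w) (cong (λ f → bit f ℕ.+ r , bit (f ∧ b) ℕ.+ p , l) (firstIsRLmin-1 pos))
  where
  r = rlmins w
  b = t <ᵇ 1
  p = pivotsAbove (pred t) w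
  l = bit b ℕ.+ lrmaxAbove (pred t) w

stats-prepend-suc : ∀ j t {w} → 1 ∈ w →
  stats t (prepend (suc (suc j)) w) ≡
    (rlmins w , pivotsAbove (suc j ⊔ pred t) w , bit (t <ᵇ suc (suc j)) ℕ.+ lrmaxAbove (suc j ⊔ pred t) w)
stats-prepend-suc j t {w} 1∈w =
  ≡.trans (stats-prepend (suc j) t w) (cong (λ f → bit f ℕ.+ r , bit (f ∧ b) ℕ.+ p , l) (firstIsRLmin-suc j 1∈w))
  where
  r = rlmins w
  b = t <ᵇ suc (suc j)
  p = pivotsAbove (suc j ⊔ pred t) w
  l = bit b ℕ.+ lrmaxAbove (suc j ⊔ pred t) w

-- Permutations as prepended permutations

letters : ℕ → List ℕ
letters m = map suc (upTo m)

InRange : ℕ → ℕ → Set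
InRange n x = 1 ≤ x × x ≤ n

IsPermutation : ℕ → List ℕ → Set
IsPermutation n σ = length σ ≡ n × All (InRange n) σ × Unique σ

∈-letters⁻ : ∀ {m a} → a ∈ letters m → InRange m a
∈-letters⁻ a∈ with i , i∈ , ≡.refl ← ∈-map⁻ suc a∈ = s≤s z≤n , ∈-upTo⁻ i∈

∈-letters⁺ : ∀ {m a} → InRange m a → a ∈ letters m
∈-letters⁺ {a = suc i} (_ , i<m) = ∈-map⁺ suc (∈-upTo⁺ i<m)

letters-unique : ∀ m → Unique (letters m)
letters-unique m = Uniqueₚ.map⁺ suc-injective (Uniqueₚ.upTo⁺ m)

concatMap-map≡cartesianProductWith : {A B C : Set} (f : A → B → C) (xs : List A) (ys : List B) →
  concatMap (λ x → map (f x) ys) xs ≡ cartesianProductWith f xs ys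
concatMap-map≡cartesianProductWith f []       ys = ≡.refl
concatMap-map≡cartesianProductWith f (x ∷ xs) ys = cong (map (f x) ys ++_) (concatMap-map≡cartesianProductWith f xs ys)

words-suc : ∀ m k → words m (suc k) ≡ cartesianProductWith (λ w a → a ∷ w) (words m k) (letters m)
words-suc m k = concatMap-map≡cartesianProductWith (λ w a → a ∷ w) (words m k) (letters m)

∈-words⁻ : ∀ {m} k {σ} → σ ∈ words m k → length σ ≡ k × All (InRange m) σ
∈-words⁻         zero        (here ≡.refl) = ≡.refl , []
∈-words⁻ {m} (suc k) {σ} σ∈
  with w , a , w∈ , a∈ , ≡.refl ← ∈-cartesianProductWith⁻ _ (words m k) (letters m)
                                    (subst (σ ∈_) (words-suc m k) σ∈)
  with len , inRange ← ∈-words⁻ k w∈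
  = cong suc len , ∈-letters⁻ a∈ ∷ inRange

∈-words⁺ : ∀ {m} k {σ} → length σ ≡ k → All (InRange m) σ → σ ∈ words m k
∈-words⁺         zero    {[]}    _   []              = here ≡.refl
∈-words⁺ {m} (suc k) {a ∷ σ} len (a∈ ∷ inRange) = subst (a ∷ σ ∈_) (≡.sym (words-suc m k))
  (∈-cartesianProductWith⁺ (λ w a → a ∷ w) (∈-words⁺ k (suc-injective len) inRange) (∈-letters⁺ a∈))

words-unique : ∀ m k → Unique (words m k)
words-unique m zero    = [] ∷ []
words-unique m (suc k) = subst Unique (≡.sym (words-suc m k))
  (Uniqueₚ.cartesianProductWith⁺ (λ w a → a ∷ w) (swap ∘ ∷-injective) (words-unique m k) (letters-unique m))

∈-𝔖⁻ : ∀ {n σ} → σ ∈ 𝔖 n → IsPermutation n σ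
∈-𝔖⁻ {n} σ∈ with σ∈words , unique ← ∈-filter⁻ unique? {xs = words n n} σ∈ =
  let len , inRange = ∈-words⁻ n σ∈words in len , inRange , unique

∈-𝔖⁺ : ∀ {n σ} → IsPermutation n σ → σ ∈ 𝔖 n
∈-𝔖⁺ {n} (len , inRange , unique) = ∈-filter⁺ unique? (∈-words⁺ n len inRange) unique

𝔖-unique : ∀ n → Unique (𝔖 n)
𝔖-unique n = Uniqueₚ.filter⁺ unique? (words-unique n n)

prepend-isPermutation : ∀ {n a w} → InRange (suc n) a → IsPermutation n w → IsPermutation (suc n) (prepend a w)
prepend-isPermutation {n} {a} {w} a∈ (len , inRange , unique) =
  cong suc (≡.trans (length-map (punchIn a) w) len) ,
  a∈ ∷ Allₚ.map⁺ (All.map punchIn-inRange inRange) ,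
  Allₚ.map⁺ (All.universal (punchIn≢ a) w) ∷ Uniqueₚ.map⁺ (punchIn-injective a) unique
  where
  punchIn-inRange : ∀ {x} → InRange n x → InRange (suc n) (punchIn a x)
  punchIn-inRange {x} (1≤x , x≤n) = ≤-trans 1≤x (x≤punchIn a x) , ≤-trans (punchIn≤suc a x) (s≤s x≤n)

map-punchIn-punchOut : ∀ {a τ} → All (a ≢_) τ → map (punchIn a) (map (punchOut a) τ) ≡ τ
map-punchIn-punchOut []           = ≡.refl
map-punchIn-punchOut (a≢y ∷ a∉τ) = cong₂ _∷_ (punchIn-punchOut a≢y) (map-punchIn-punchOut a∉τ)

punchOut-isPermutation : ∀ {n a τ} → IsPermutation (suc n) (a ∷ τ) → IsPermutation n (map (punchOut a) τ)
punchOut-isPermutation {n} {a} {τ} (len , (1≤a , a≤n) ∷ inRange , a∉τ ∷ unique) =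
  ≡.trans (length-map (punchOut a) τ) (suc-injective len) ,
  Allₚ.map⁺ (All.zipWith (λ ((1≤y , y≤n) , a≢y) → punchOut-inRange 1≤a a≤n 1≤y y≤n a≢y) (inRange , a∉τ)) ,
  Uniqueₚ.map⁻ (subst Unique (≡.sym (map-punchIn-punchOut a∉τ)) unique)
  where
  punchOut-inRange : ∀ {a y} → 1 ≤ a → a ≤ suc n → 1 ≤ y → y ≤ suc n → a ≢ y → InRange n (punchOut a y)
  punchOut-inRange (s≤s _) (s≤s a≤n) (s≤s _) (s≤s y≤n) a≢y = s≤s z≤n , punchOut-< (a≢y ∘ cong suc) a≤n y≤n

prepend-injective : ∀ {w v a b} → prepend a w ≡ prepend b v → w ≡ v × a ≡ b
prepend-injective {a = a} eq with ≡.refl , tail ← ∷-injective eq = map-injective (punchIn-injective a) tail , ≡.refl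

prepend𝔖 : ℕ → List (List ℕ)
prepend𝔖 n = cartesianProductWith (λ w a → prepend a w) (𝔖 n) (letters (suc n))

𝔖-suc↭ : ∀ n → 𝔖 (suc n) ↭ prepend𝔖 n
𝔖-suc↭ n = ∼bag⇒↭ (unique∧set⇒bag (𝔖-unique (suc n))
  (Uniqueₚ.cartesianProductWith⁺ (λ w a → prepend a w) prepend-injective (𝔖-unique n) (letters-unique (suc n)))
  (mk⇔ decompose compose))
  where
  decompose : ∀ {σ} → σ ∈ 𝔖 (suc n) → σ ∈ prepend𝔖 n
  decompose {[]}    σ∈ with () ← proj₁ (∈-𝔖⁻ {suc n} σ∈)
  decompose {a ∷ τ} σ∈ with isPerm@(_ , a∈ ∷ _ , a∉τ ∷ _) ← ∈-𝔖⁻ {suc n} σ∈ =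
    subst (_∈ prepend𝔖 n) (cong (a ∷_) (map-punchIn-punchOut a∉τ))
      (∈-cartesianProductWith⁺ (λ w a → prepend a w) (∈-𝔖⁺ {n} (punchOut-isPermutation isPerm)) (∈-letters⁺ a∈))
  compose : ∀ {σ} → σ ∈ prepend𝔖 n → σ ∈ 𝔖 (suc n)
  compose σ∈ with w , a , w∈ , a∈ , ≡.refl ← ∈-cartesianProductWith⁻ _ (𝔖 n) (letters (suc n)) σ∈ =
    ∈-𝔖⁺ {suc n} (prepend-isPermutation (∈-letters⁻ a∈) (∈-𝔖⁻ {n} w∈))

∈-𝔖-suc⁻ : ∀ {n σ} → σ ∈ 𝔖 (suc n) → ∃₂ λ w j → w ∈ 𝔖 n × j < suc n × σ ≡ prepend (suc j) w
∈-𝔖-suc⁻ {n} σ∈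
  with w , a , w∈ , a∈ , ≡.refl ← ∈-cartesianProductWith⁻ _ (𝔖 n) (letters (suc n))
                                    (∈-resp-↭ (𝔖-suc↭ n) σ∈)
  with j , j∈ , ≡.refl ← ∈-map⁻ suc a∈
  = w , j , w∈ , ∈-upTo⁻ j∈ , ≡.refl

∈-𝔖⇒positive : ∀ {n σ} → σ ∈ 𝔖 n → All (1 ≤_) σ
∈-𝔖⇒positive {n} σ∈ = All.map proj₁ (proj₁ (proj₂ (∈-𝔖⁻ {n} σ∈)))

1∈𝔖 : ∀ n {σ} → σ ∈ 𝔖 (suc n) → 1 ∈ σ
1∈𝔖 n σ∈ with ∈-𝔖-suc⁻ {n} σ∈
1∈𝔖 n       σ∈ | w , zero  , _  , _      , ≡.refl = here ≡.refl
1∈𝔖 (suc n) σ∈ | w , suc j , w∈ , _      , ≡.refl = there (∈-map⁺ (punchIn (suc (suc j))) (1∈𝔖 n w∈))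
1∈𝔖 zero    σ∈ | w , suc j , _  , s≤s () , ≡.refl

1≤rlmins-𝔖 : ∀ n {σ} → σ ∈ 𝔖 (suc n) → 1 ≤ rlmins σ
1≤rlmins-𝔖 n {[]}    σ∈ with () ← proj₁ (∈-𝔖⁻ {suc n} σ∈)
1≤rlmins-𝔖 n {x ∷ w} _  = 1≤rlmins x w

module ListSum {c ℓ : Level} (R : CommutativeSemiring c ℓ) where

  open CommutativeSemiring R
  open import Relation.Binary.Reasoning.Setoid setoid
  open import Algebra.Properties.CommutativeSemigroup +-commutativeSemigroup using () renaming (interchange to +-interchange)

  ∑-syntax : {A : Set} → List A → (A → Carrier) → Carrier
  ∑-syntax = sumOver R

  syntax ∑-syntax xs (λ x → e) = ∑[ x ∈ xs ] e

  ∑-cong : {A : Set} (xs : List A) {f g : A → Carrier} →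
           (∀ {x} → x ∈ xs → f x ≈ g x) → ∑[ x ∈ xs ] f x ≈ ∑[ x ∈ xs ] g x
  ∑-cong []       f≈g = refl
  ∑-cong (x ∷ xs) f≈g = +-cong (f≈g (here ≡.refl)) (∑-cong xs (f≈g ∘ there))

  ∑-map : {A B : Set} (h : A → B) (xs : List A) (f : B → Carrier) → ∑[ y ∈ map h xs ] f y ≡ ∑[ x ∈ xs ] f (h x)
  ∑-map h []       f = ≡.refl
  ∑-map h (x ∷ xs) f = cong (f (h x) +_) (∑-map h xs f)

  ∑-++ : {A : Set} (xs ys : List A) (f : A → Carrier) → ∑[ x ∈ xs ++ ys ] f x ≈ ∑[ x ∈ xs ] f x + ∑[ y ∈ ys ] f y
  ∑-++ []       ys f = sym (+-identityˡ _)
  ∑-++ (x ∷ xs) ys f = trans (+-congˡ (∑-++ xs ys f)) (sym (+-assoc _ _ _))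

  ∑-0 : {A : Set} (xs : List A) → ∑[ x ∈ xs ] 0# ≈ 0#
  ∑-0 []       = refl
  ∑-0 (x ∷ xs) = trans (+-identityˡ _) (∑-0 xs)

  ∑-+ : {A : Set} (xs : List A) (f g : A → Carrier) → ∑[ x ∈ xs ] (f x + g x) ≈ ∑[ x ∈ xs ] f x + ∑[ x ∈ xs ] g x
  ∑-+ []       f g = sym (+-identityˡ _)
  ∑-+ (x ∷ xs) f g = trans (+-congˡ (∑-+ xs f g)) (+-interchange (f x) (g x) _ _)

  ∑-distribˡ : {A : Set} (k : Carrier) (xs : List A) (f : A → Carrier) → k * ∑[ x ∈ xs ] f x ≈ ∑[ x ∈ xs ] (k * f x)
  ∑-distribˡ k []       f = zeroʳ k
  ∑-distribˡ k (x ∷ xs) f = trans (distribˡ k _ _) (+-congˡ (∑-distribˡ k xs f))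

  ∑-swap : {A B : Set} (xs : List A) (ys : List B) (g : A → B → Carrier) →
           ∑[ x ∈ xs ] ∑[ y ∈ ys ] g x y ≈ ∑[ y ∈ ys ] ∑[ x ∈ xs ] g x y
  ∑-swap []       ys g = sym (∑-0 ys)
  ∑-swap (x ∷ xs) ys g = trans (+-congˡ (∑-swap xs ys g)) (sym (∑-+ ys (g x) _))

  ∑-↭ : {A : Set} {xs ys : List A} (f : A → Carrier) → xs ↭ ys → ∑[ x ∈ xs ] f x ≈ ∑[ y ∈ ys ] f y
  ∑-↭ f ↭.refl         = refl
  ∑-↭ f (↭.prep x p)   = +-congˡ (∑-↭ f p)
  ∑-↭ f (↭.swap x y p) = trans (sym (+-assoc _ _ _)) (trans (+-cong (+-comm _ _) (∑-↭ f p)) (+-assoc _ _ _))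
  ∑-↭ f (↭.trans p q)  = trans (∑-↭ f p) (∑-↭ f q)

  ∑-cartesianProductWith : {A B C : Set} (h : A → B → C) (xs : List A) (ys : List B) (f : C → Carrier) →
    ∑[ z ∈ cartesianProductWith h xs ys ] f z ≈ ∑[ x ∈ xs ] ∑[ y ∈ ys ] f (h x y)
  ∑-cartesianProductWith h []       ys f = refl
  ∑-cartesianProductWith h (x ∷ xs) ys f = begin
    ∑[ z ∈ map (h x) ys ++ cartesianProductWith h xs ys ] f z
      ≈⟨ ∑-++ (map (h x) ys) _ f ⟩
    ∑[ z ∈ map (h x) ys ] f z + ∑[ z ∈ cartesianProductWith h xs ys ] f z
      ≈⟨ +-cong (reflexive (∑-map (h x) ys f)) (∑-cartesianProductWith h xs ys f) ⟩
    ∑[ y ∈ ys ] f (h x y) + ∑[ x ∈ xs ] ∑[ y ∈ ys ] f (h x y)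
      ∎

  ∑-upTo-suc : ∀ n (f : ℕ → Carrier) → ∑[ j ∈ upTo (suc n) ] f j ≡ f 0 + ∑[ j ∈ upTo n ] f (suc j)
  ∑-upTo-suc n f =
    cong (f 0 +_) (≡.trans (cong (λ js → ∑[ j ∈ js ] f j) (≡.sym (map-upTo suc n))) (∑-map suc (upTo n) f))

  ∑-𝔖-suc : ∀ n (f : List ℕ → Carrier) →
    ∑[ σ ∈ 𝔖 (suc n) ] f σ ≈ ∑[ w ∈ 𝔖 n ] ∑[ j ∈ upTo (suc n) ] f (prepend (suc j) w)
  ∑-𝔖-suc n f = begin
    ∑[ σ ∈ 𝔖 (suc n) ] f σ
      ≈⟨ ∑-↭ f (𝔖-suc↭ n) ⟩
    ∑[ σ ∈ prepend𝔖 n ] f σ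
      ≈⟨ ∑-cartesianProductWith _ (𝔖 n) (letters (suc n)) f ⟩
    ∑[ w ∈ 𝔖 n ] ∑[ a ∈ letters (suc n) ] f (prepend a w)
      ≈⟨ ∑-cong (𝔖 n) (λ {w} _ → reflexive (∑-map suc (upTo (suc n)) (λ a → f (prepend a w)))) ⟩
    ∑[ w ∈ 𝔖 n ] ∑[ j ∈ upTo (suc n) ] f (prepend (suc j) w)
      ∎

-- The weights

module Weights {c ℓ : Level} (R : CommutativeSemiring c ℓ) (X Y : CommutativeSemiring.Carrier R) where

  open CommutativeSemiring R
  open import Algebra.Properties.Semiring.Exp semiring using (_^_; ^-homo-*)
  open import Algebra.Properties.CommutativeSemigroup *-commutativeSemigroup using (x∙yz≈y∙xz)
  open import Relation.Binary.Reasoning.Setoid setoid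
  open ListSum R

  weightˡ weightʳ : Stats → Carrier
  weightˡ (r , p , l) = (X + 1#) ^ (r ∸ p) * ((X + Y) ^ p * Y ^ (l ∸ p))
  weightʳ (r , p , l) = X ^ (r ∸ 1) * Y ^ (l ∸ p)

  weightˡ-rlmin : ∀ {r p} l → p ≤ r → weightˡ (suc r , p , l) ≈ (X + 1#) * weightˡ (r , p , l)
  weightˡ-rlmin {r} {p} l p≤r =
    trans (reflexive (cong (λ k → (X + 1#) ^ k * ((X + Y) ^ p * Y ^ (l ∸ p))) (+-∸-assoc 1 p≤r))) (*-assoc _ _ _)

  weightˡ-pivot : ∀ r p l → weightˡ (suc r , suc p , suc l) ≈ (X + Y) * weightˡ (r , p , l)
  weightˡ-pivot r p l = trans (*-congˡ (*-assoc _ _ _)) (x∙yz≈y∙xz _ _ _)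

  weightˡ-lrmax : ∀ r {p l} k → p ≤ l → weightˡ (r , p , k ℕ.+ l) ≈ Y ^ k * weightˡ (r , p , l)
  weightˡ-lrmax r {p} {l} k p≤l = begin
    (X + 1#) ^ (r ∸ p) * ((X + Y) ^ p * Y ^ (k ℕ.+ l ∸ p))
      ≡⟨ cong (λ m → (X + 1#) ^ (r ∸ p) * ((X + Y) ^ p * Y ^ m)) (+-∸-assoc k p≤l) ⟩
    (X + 1#) ^ (r ∸ p) * ((X + Y) ^ p * Y ^ (k ℕ.+ (l ∸ p)))
      ≈⟨ *-congˡ (*-congˡ (^-homo-* Y k (l ∸ p))) ⟩
    (X + 1#) ^ (r ∸ p) * ((X + Y) ^ p * (Y ^ k * Y ^ (l ∸ p)))
      ≈⟨ *-congˡ (x∙yz≈y∙xz _ _ _) ⟩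
    (X + 1#) ^ (r ∸ p) * (Y ^ k * ((X + Y) ^ p * Y ^ (l ∸ p)))
      ≈⟨ x∙yz≈y∙xz _ _ _ ⟩
    Y ^ k * weightˡ (r , p , l)
      ∎

  weightʳ-rlmin : ∀ {r} p l → 1 ≤ r → weightʳ (suc r , p , l) ≈ X * weightʳ (r , p , l)
  weightʳ-rlmin p l (s≤s _) = *-assoc _ _ _

  weightʳ-pivot : ∀ r p l k → weightʳ (r , k ℕ.+ p , k ℕ.+ l) ≡ weightʳ (r , p , l)
  weightʳ-pivot r p l k = cong (λ m → X ^ (r ∸ 1) * Y ^ m) ([m+n]∸[m+o]≡n∸o k l p)

  weightʳ-lrmax : ∀ r {p l} k → p ≤ l → weightʳ (r , p , k ℕ.+ l) ≈ Y ^ k * weightʳ (r , p , l)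
  weightʳ-lrmax r {p} {l} k p≤l = begin
    X ^ (r ∸ 1) * Y ^ (k ℕ.+ l ∸ p)         ≡⟨ cong (λ m → X ^ (r ∸ 1) * Y ^ m) (+-∸-assoc k p≤l) ⟩
    X ^ (r ∸ 1) * Y ^ (k ℕ.+ (l ∸ p))       ≈⟨ *-congˡ (^-homo-* Y k (l ∸ p)) ⟩
    X ^ (r ∸ 1) * (Y ^ k * Y ^ (l ∸ p))     ≈⟨ x∙yz≈y∙xz _ _ _ ⟩
    Y ^ k * weightʳ (r , p , l)             ∎

  leftWeight rightWeight : ℕ → List ℕ → Carrier
  leftWeight  t w = weightˡ (stats t w)
  rightWeight t w = weightʳ (stats t w)

  firstFactorˡ firstFactorʳ : ℕ → ℕ → Carrier
  firstFactorˡ zero    zero    = X + Y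
  firstFactorˡ zero    (suc t) = X + 1#
  firstFactorˡ (suc j) t       = Y ^ bit (t <ᵇ suc (suc j))
  firstFactorʳ zero    t       = X
  firstFactorʳ (suc j) t       = Y ^ bit (t <ᵇ suc (suc j))

  leftWeight-prepend : ∀ {n w} j t → w ∈ 𝔖 n → j < suc n →
    leftWeight t (prepend (suc j) w) ≈ firstFactorˡ j t * leftWeight (j ⊔ pred t) w
  leftWeight-prepend {n} {w} zero zero w∈ _ =
    trans (reflexive (cong weightˡ (stats-prepend-1 0 (∈-𝔖⇒positive {n} w∈))))
          (weightˡ-pivot (rlmins w) (pivotsAbove 0 w) (lrmaxAbove 0 w))
  leftWeight-prepend {n} {w} zero (suc t) w∈ _ =
    trans (reflexive (cong weightˡ (stats-prepend-1 (suc t) (∈-𝔖⇒positive {n} w∈))))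
          (weightˡ-rlmin (lrmaxAbove t w) (pivotsAbove≤rlmins t w))
  leftWeight-prepend {zero}      (suc j) t _  (s≤s ())
  leftWeight-prepend {suc n} {w} (suc j) t w∈ _ =
    trans (reflexive (cong weightˡ (stats-prepend-suc j t (1∈𝔖 n w∈))))
          (weightˡ-lrmax (rlmins w) (bit (t <ᵇ suc (suc j))) (pivotsAbove≤lrmaxAbove (suc j ⊔ pred t) w))

  rightWeight-prepend : ∀ {n w} j t → w ∈ 𝔖 (suc n) → j < suc (suc n) →
    rightWeight t (prepend (suc j) w) ≈ firstFactorʳ j t * rightWeight (j ⊔ pred t) w
  rightWeight-prepend {n} {w} zero t w∈ _ = begin
    rightWeight t (prepend 1 w)
      ≡⟨ cong weightʳ (stats-prepend-1 t (∈-𝔖⇒positive {suc n} w∈)) ⟩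
    weightʳ (suc (rlmins w) , bit (t <ᵇ 1) ℕ.+ pivotsAbove (pred t) w , bit (t <ᵇ 1) ℕ.+ lrmaxAbove (pred t) w)
      ≡⟨ weightʳ-pivot (suc (rlmins w)) (pivotsAbove (pred t) w) (lrmaxAbove (pred t) w) (bit (t <ᵇ 1)) ⟩
    weightʳ (suc (rlmins w) , pivotsAbove (pred t) w , lrmaxAbove (pred t) w)
      ≈⟨ weightʳ-rlmin (pivotsAbove (pred t) w) (lrmaxAbove (pred t) w) (1≤rlmins-𝔖 n w∈) ⟩
    X * rightWeight (pred t) w
      ∎
  rightWeight-prepend {n} {w} (suc j) t w∈ _ =
    trans (reflexive (cong weightʳ (stats-prepend-suc j t (1∈𝔖 n w∈))))
          (weightʳ-lrmax (rlmins w) (bit (t <ᵇ suc (suc j))) (pivotsAbove≤lrmaxAbove (suc j ⊔ pred t) w))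

  rightWeight-0≡1 : ∀ n {σ} → σ ∈ 𝔖 (suc n) → rightWeight 0 σ ≡ rightWeight 1 σ
  rightWeight-0≡1 n σ∈ with ∈-𝔖-suc⁻ {n} σ∈
  ... | w , zero , w∈ , _ , ≡.refl =
    ≡.trans (cong weightʳ (stats-prepend-1 0 pos)) (≡.sym (cong weightʳ (stats-prepend-1 1 pos)))
    where pos = ∈-𝔖⇒positive {n} w∈
  rightWeight-0≡1 (suc n) σ∈ | w , suc j , w∈ , _ , ≡.refl =
    ≡.trans (cong weightʳ (stats-prepend-suc j 0 1∈w)) (≡.sym (cong weightʳ (stats-prepend-suc j 1 1∈w)))
    where 1∈w = 1∈𝔖 n w∈
  rightWeight-0≡1 zero σ∈ | w , suc j , _ , s≤s () , _

  ∑-firstFactors : ∀ n t {σ} → rightWeight 0 σ ≡ rightWeight 1 σ →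
    ∑[ j ∈ upTo (suc n) ] (firstFactorˡ j t * rightWeight (suc (j ⊔ pred t)) σ) ≈
    ∑[ j ∈ upTo (suc (suc n)) ] (firstFactorʳ j (suc t) * rightWeight (j ⊔ t) σ)
  ∑-firstFactors n t {σ} R₀≡R₁ = begin
    ∑[ j ∈ upTo (suc n) ] lhs j                          ≡⟨ ∑-upTo-suc n lhs ⟩
    lhs 0 + ∑[ j ∈ upTo n ] lhs (suc j)                  ≈⟨ +-cong (letter-1 t) (∑-cong (upTo n) λ _ → reflexive (lhs≡rhs _)) ⟩
    (rhs 0 + rhs 1) + ∑[ j ∈ upTo n ] rhs (suc (suc j))  ≈⟨ +-assoc _ _ _ ⟩
    rhs 0 + (rhs 1 + ∑[ j ∈ upTo n ] rhs (suc (suc j)))  ≡⟨ cong (rhs 0 +_) (∑-upTo-suc n (rhs ∘ suc)) ⟨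
    rhs 0 + ∑[ j ∈ upTo (suc n) ] rhs (suc j)            ≡⟨ ∑-upTo-suc (suc n) rhs ⟨
    ∑[ j ∈ upTo (suc (suc n)) ] rhs j                    ∎
    where
    lhs rhs : ℕ → Carrier
    lhs j = firstFactorˡ j t * rightWeight (suc (j ⊔ pred t)) σ
    rhs j = firstFactorʳ j (suc t) * rightWeight (j ⊔ t) σ
    lhs≡rhs : ∀ j → lhs (suc j) ≡ rhs (suc (suc j))
    lhs≡rhs j = cong (λ m → firstFactorˡ (suc j) t * rightWeight m σ) (≡.sym (suc-⊔ (suc j) t))
    letter-1 : ∀ t → firstFactorˡ 0 t * rightWeight (suc (pred t)) σ ≈
                     firstFactorʳ 0 (suc t) * rightWeight t σ + firstFactorʳ 1 (suc t) * rightWeight (1 ⊔ t) σ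
    letter-1 zero    =
      trans (distribʳ _ X Y) (+-cong (*-congˡ (reflexive (≡.sym R₀≡R₁))) (*-congʳ (sym (*-identityʳ Y))))
    letter-1 (suc t) = distribʳ _ X 1#

  leftWeight-sum : ∀ n t → ∑[ w ∈ 𝔖 n ] leftWeight t w ≈ ∑[ σ ∈ 𝔖 (suc n) ] rightWeight (suc t) σ
  leftWeight-sum zero    t = +-congʳ (*-congˡ (*-identityʳ 1#))
  leftWeight-sum (suc n) t = begin
    ∑[ w ∈ 𝔖 (suc n) ] leftWeight t w
      ≈⟨ ∑-𝔖-suc n (leftWeight t) ⟩
    ∑[ w ∈ 𝔖 n ] ∑[ j ∈ upTo (suc n) ] leftWeight t (prepend (suc j) w)
      ≈⟨ ∑-cong (𝔖 n) (λ w∈ → ∑-cong (upTo (suc n)) λ j∈ → leftWeight-prepend _ t w∈ (∈-upTo⁻ j∈)) ⟩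
    ∑[ w ∈ 𝔖 n ] ∑[ j ∈ upTo (suc n) ] (firstFactorˡ j t * leftWeight (j ⊔ pred t) w)
      ≈⟨ ∑-swap (𝔖 n) (upTo (suc n)) _ ⟩
    ∑[ j ∈ upTo (suc n) ] ∑[ w ∈ 𝔖 n ] (firstFactorˡ j t * leftWeight (j ⊔ pred t) w)
      ≈⟨ ∑-cong (upTo (suc n)) (λ {j} _ → factor-induction j) ⟩
    ∑[ j ∈ upTo (suc n) ] ∑[ σ ∈ 𝔖 (suc n) ] (firstFactorˡ j t * rightWeight (suc (j ⊔ pred t)) σ)
      ≈⟨ ∑-swap (upTo (suc n)) (𝔖 (suc n)) _ ⟩
    ∑[ σ ∈ 𝔖 (suc n) ] ∑[ j ∈ upTo (suc n) ] (firstFactorˡ j t * rightWeight (suc (j ⊔ pred t)) σ)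
      ≈⟨ ∑-cong (𝔖 (suc n)) (λ {σ} σ∈ → ∑-firstFactors n t {σ} (rightWeight-0≡1 n σ∈)) ⟩
    ∑[ σ ∈ 𝔖 (suc n) ] ∑[ j ∈ upTo (suc (suc n)) ] (firstFactorʳ j (suc t) * rightWeight (j ⊔ t) σ)
      ≈⟨ ∑-cong (𝔖 (suc n)) (λ σ∈ → ∑-cong (upTo (suc (suc n))) λ j∈ →
           sym (rightWeight-prepend _ (suc t) σ∈ (∈-upTo⁻ j∈))) ⟩
    ∑[ σ ∈ 𝔖 (suc n) ] ∑[ j ∈ upTo (suc (suc n)) ] rightWeight (suc t) (prepend (suc j) σ)
      ≈⟨ ∑-𝔖-suc (suc n) (rightWeight (suc t)) ⟨
    ∑[ σ ∈ 𝔖 (suc (suc n)) ] rightWeight (suc t) σ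
      ∎
    where
    factor-induction : ∀ j → ∑[ w ∈ 𝔖 n ] (firstFactorˡ j t * leftWeight (j ⊔ pred t) w) ≈
                             ∑[ σ ∈ 𝔖 (suc n) ] (firstFactorˡ j t * rightWeight (suc (j ⊔ pred t)) σ)
    factor-induction j = begin
      ∑[ w ∈ 𝔖 n ] (firstFactorˡ j t * leftWeight (j ⊔ pred t) w)
        ≈⟨ ∑-distribˡ _ (𝔖 n) _ ⟨
      firstFactorˡ j t * ∑[ w ∈ 𝔖 n ] leftWeight (j ⊔ pred t) w
        ≈⟨ *-congˡ (leftWeight-sum n (j ⊔ pred t)) ⟩
      firstFactorˡ j t * ∑[ σ ∈ 𝔖 (suc n) ] rightWeight (suc (j ⊔ pred t)) σ
        ≈⟨ ∑-distribˡ _ (𝔖 (suc n)) _ ⟩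
      ∑[ σ ∈ 𝔖 (suc n) ] (firstFactorˡ j t * rightWeight (suc (j ⊔ pred t)) σ)
        ∎

open import Algebra.Definitions.RawSemiring using (_^_)

corollary3p7 : {c ℓ : Level} (R : CommutativeSemiring c ℓ) →
    (X Y : CommutativeSemiring.Carrier R) (n : ℕ) →
    CommutativeSemiring._≈_ R
      (sumOver R (𝔖 n) (λ π →
        CommutativeSemiring._*_ R
          (_^_ (CommutativeSemiring.rawSemiring R) (CommutativeSemiring._+_ R X (CommutativeSemiring.1# R)) (RLmin π ∸ pivot π))
          (CommutativeSemiring._*_ R
            (_^_ (CommutativeSemiring.rawSemiring R) (CommutativeSemiring._+_ R X Y) (pivot π))
            (_^_ (CommutativeSemiring.rawSemiring R) Y (LRmax π ∸ pivot π)))))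
      (sumOver R (𝔖 (suc n)) (λ π →
        CommutativeSemiring._*_ R
          (_^_ (CommutativeSemiring.rawSemiring R) X (RLmin π ∸ 1))
          (_^_ (CommutativeSemiring.rawSemiring R) Y (LRmax π ∸ pivot π))))
corollary3p7 R X Y n = begin
  ∑[ π ∈ 𝔖 n ] weightˡ (RLmin π , pivot π , LRmax π)
    ≈⟨ ∑-cong (𝔖 n) (λ π∈ → reflexive (cong weightˡ (stats-0 (∈-𝔖⇒positive {n} π∈)))) ⟩
  ∑[ π ∈ 𝔖 n ] leftWeight 0 π
    ≈⟨ leftWeight-sum n 0 ⟩
  ∑[ π ∈ 𝔖 (suc n) ] rightWeight 1 π
    ≈⟨ ∑-cong (𝔖 (suc n)) (λ π∈ → reflexive (rightWeight-0≡1 n π∈)) ⟨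
  ∑[ π ∈ 𝔖 (suc n) ] rightWeight 0 π
    ≈⟨ ∑-cong (𝔖 (suc n)) (λ π∈ → reflexive (cong weightʳ (stats-0 (∈-𝔖⇒positive {suc n} π∈)))) ⟨
  ∑[ π ∈ 𝔖 (suc n) ] weightʳ (RLmin π , pivot π , LRmax π)
    ∎
  where
  open CommutativeSemiring R using (reflexive; setoid)
  open import Relation.Binary.Reasoning.Setoid setoid
  open ListSum R
  open Weights R X Y
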